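{- Let $p$ be a prime, and in the field $\mathbb{Q}_p$ of $p$-adic numbers let $\alpha=\sum_{n=1}^{\infty}n!$ and, for a nonnegative integer $k$, $\alpha_k=\sum_{n=1}^{\infty}n^k\,n!$ (these series converge $p$-adically). If $\alpha\notin\mathbb{Q}$ and $k+1\not\equiv 2\pmod{3145728}$ and $k+1\not\equiv 2944838\pmod{3145728}$, then $\alpha_k\notin\mathbb{Q}$.
   Context: A $p$-adic irrational is an element of $\mathbb{Q}_p\setminus\mathbb{Q}$. -}

module Defs where

open import Data.Nat using (ℕ; zero; suc; _≤_; _^_; _!)
open import Data.Integer using (ℤ; +_; _-_; _*_; _+_)
import Data.Integer as ℤ
open import Data.Integer.Divisibility using (_∣_)
open import Data.Product using (Σ; ∃; _×_)
open import Relation.Binary.PropositionalEquality using (_≢_)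

partialSum : (ℕ → ℤ) → ℕ → ℤ
partialSum t zero = + 0
partialSum t (suc N) = partialSum t N + t (suc N)

-- The p-adic limit of the partial sums of Σ_{n≥1} t n equals the rational a / b
-- (b ≠ 0): i.e. b · S_N − a → 0 p-adically, i.e. for every m, eventually
-- p^m divides b · S_N − a.
SeriesEqualsRational : ℕ → (ℕ → ℤ) → ℤ → ℤ → Set
SeriesEqualsRational p t a b =
  (m : ℕ) → ∃ λ N → (N' : ℕ) → N ≤ N' →
    ((+ p) ℤ.^ m) ∣ (b * partialSum t N' - a)

SeriesIsRational : ℕ → (ℕ → ℤ) → Set
SeriesIsRational p t = ∃ λ a → ∃ λ b → (b ≢ + 0) × SeriesEqualsRational p t a b

αTerm : ℕ → ℤ
αTerm n = + (n !)

αkTerm : ℕ → ℕ → ℤ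
αkTerm k n = + ((n ^ k) Data.Nat.* (n !))

module Submission where

-- Every f ∈ ℤ[x] has integers A, B with Σ_{n ≤ N} f(n) n! ≡ A + B Σ_{n ≤ N} n! (mod N!) for all N:
-- divide f by x + 1 and telescope (x + 1) g(x) n! = g(x) (n + 1)!. These congruences are p-adic
-- limits, so Σ f(n) n! = A + B α in ℚ_p, and when α is irrational B is determined by f, hence
-- ℤ-linear in f; α_k is then irrational as soon as the coefficient β k of x^k is non-zero.
--
-- With H₀ = 1 and H_{r+1}(x) = (x + 1)(x + 2) H_r(x + 2) − H_r(x), telescoping twice shows that the
-- coefficient of H_{r+1} g equals that of H_r(x) (g(x − 2) − g(x)), and g(x − 2) − g(x) has even
-- coefficients; so 2^r divides the coefficient of H_r g. As H₂₂ is monic of degree 44, β satisfies a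
-- linear recurrence of order 44 modulo 2^22. Powers of its companion matrix show that β mod 2^e has
-- period 3·2^e, and refining residue classes level by level shows that β k ≢ 0 modulo some 2^e,
-- except on the two classes of k modulo 3·2^20 excluded by the hypotheses.

open import Data.Nat as ℕ using (ℕ; zero; suc; _!; _≡ᵇ_; NonZero)
import Data.Nat.Properties as ℕ
import Data.Nat.DivMod as ℕ
import Data.Nat.Divisibility as ℕ
import Data.Nat.Tactic.RingSolver as ℕ
open import Data.Nat.Induction using (<-rec)
open import Data.Nat.Primality using (Prime; prime⇒nonZero)
open import Data.Integer as ℤ using (ℤ; +_; -_)
import Data.Integer.Properties as ℤ
import Data.Integer.DivMod as ℤ
open import Data.Integer.Divisibility using () renaming (_∣_ to _∣ᵤ_)
open import Data.Integer.Divisibility.Signed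
open import Data.Integer.Tactic.RingSolver using (solve-∀)
open import Algebra.Properties.Ring ℤ.+-*-ring using (x[y-z]≈xy-xz; [y-z]x≈yx-zx)
open import Algebra.Properties.AbelianGroup ℤ.+-0-abelianGroup using (⁻¹-anti-homo‿-)
import Data.Fin as Fin
import Data.Fin.Properties as Fin
open import Data.Bool using (Bool; true; false; T; not; _∧_; _∨_)
open import Data.Bool.Properties using (T-∧; T-∨; T-not-≡)
open import Data.List using (List; []; _∷_)
open import Data.Vec using (Vec; []; _∷_; [_]; _∷ʳ_; zipWith; map; replicate; sum; head; init; last; initLast)
open import Data.Unit using (⊤; tt)
open import Data.Product using (∃; _×_; _,_; proj₁; proj₂)
open import Data.Sum using (inj₁; inj₂; [_,_]′)
open import Function using (_∘_)
open import Function.Bundles using (Equivalence)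
open import Relation.Nullary using (¬_; yes; no; contradiction)
open import Relation.Binary.Bundles using (Setoid)
open import Relation.Binary.Structures using (IsEquivalence)
open import Relation.Binary.PropositionalEquality hiding ([_])
import Relation.Binary.Reasoning.Setoid

open import Defs

module Congruence where

  open import Data.Integer using (_+_; _*_; _-_)

  infix 4 _≡_mod_

  record _≡_mod_ (a b : ℤ) (m : ℕ) : Set where
    constructor congruent
    field divides-difference : + m ∣ a - b

  module _ {m : ℕ} where

    mod-reflexive : ∀ {a b} → a ≡ b → a ≡ b mod m
    mod-reflexive {a} refl = congruent (divides (+ 0) (ℤ.+-inverseʳ a))

    mod-refl : ∀ {a} → a ≡ a mod m
    mod-refl = mod-reflexive refl

    mod-sym : ∀ {a b} → a ≡ b mod m → b ≡ a mod m
    mod-sym {a} {b} (congruent m∣a-b) = congruent (subst (+ m ∣_) (⁻¹-anti-homo‿- a b) (∣m⇒∣-m m∣a-b))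

    mod-trans : ∀ {a b c} → a ≡ b mod m → b ≡ c mod m → a ≡ c mod m
    mod-trans {a} {b} {c} (congruent m∣a-b) (congruent m∣b-c) =
      congruent (subst (+ m ∣_) (ℤ.+-minus-telescope a b c) (∣m∣n⇒∣m+n m∣a-b m∣b-c))

    +-mod-cong : ∀ {a b c d} → a ≡ b mod m → c ≡ d mod m → a + c ≡ b + d mod m
    +-mod-cong {a} {b} {c} {d} (congruent m∣a-b) (congruent m∣c-d) =
      congruent (subst (+ m ∣_) (regroup a b c d) (∣m∣n⇒∣m+n m∣a-b m∣c-d))
      where
      regroup : ∀ a b c d → (a - b) + (c - d) ≡ (a + c) - (b + d)
      regroup = solve-∀

    −-mod-cong : ∀ {a b c d} → a ≡ b mod m → c ≡ d mod m → a - c ≡ b - d mod m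
    −-mod-cong {a} {b} {c} {d} (congruent m∣a-b) (congruent m∣c-d) =
      congruent (subst (+ m ∣_) (regroup a b c d) (∣m∣n⇒∣m-n m∣a-b m∣c-d))
      where
      regroup : ∀ a b c d → (a - b) - (c - d) ≡ (a - c) - (b - d)
      regroup = solve-∀

    *-mod-congˡ : ∀ c {a b} → a ≡ b mod m → c * a ≡ c * b mod m
    *-mod-congˡ c {a} {b} (congruent m∣a-b) = congruent (subst (+ m ∣_) (x[y-z]≈xy-xz c a b) (∣n⇒∣m*n c m∣a-b))

    *-mod-congʳ : ∀ c {a b} → a ≡ b mod m → a * c ≡ b * c mod m
    *-mod-congʳ c {a} {b} (congruent m∣a-b) = congruent (subst (+ m ∣_) ([y-z]x≈yx-zx c a b) (∣m⇒∣m*n c m∣a-b))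

    mod-isEquivalence : IsEquivalence (λ a b → a ≡ b mod m)
    mod-isEquivalence = record { refl = mod-refl ; sym = mod-sym ; trans = mod-trans }

    mod-+-multiple : ∀ r q → r + q * + m ≡ r mod m
    mod-+-multiple r q = congruent (divides q (cancel r (q * + m)))
      where
      cancel : ∀ a b → (a + b) - a ≡ b
      cancel = solve-∀

  mod-setoid : ℕ → Setoid _ _
  mod-setoid m = record { isEquivalence = mod-isEquivalence {m} }

  module mod-Reasoning (m : ℕ) = Relation.Binary.Reasoning.Setoid (mod-setoid m)

  mod-weaken : ∀ {q m a b} → q ℕ.∣ m → a ≡ b mod m → a ≡ b mod q
  mod-weaken {q} (ℕ.divides k refl) (congruent m∣a-b) =
    congruent (∣-trans (divides (+ k) (ℤ.pos-* k q)) m∣a-b)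

  %ℕ-mod : ∀ m .{{_ : NonZero m}} z → + (z ℤ.%ℕ m) ≡ z mod m
  %ℕ-mod m z = mod-sym (subst (_≡ + (z ℤ.%ℕ m) mod m) (sym (ℤ.a≡a%ℕn+[a/ℕn]*n z m))
                               (mod-+-multiple _ (z ℤ./ℕ m)))

  %-≡⇒mod : ∀ q .{{_ : NonZero q}} x y → x ℕ.% q ≡ y ℕ.% q → + x ≡ + y mod q
  %-≡⇒mod q x y x%q≡y%q =
    mod-trans (mod-sym (%ℕ-mod q (+ x))) (mod-trans (mod-reflexive (cong +_ x%q≡y%q)) (%ℕ-mod q (+ y)))

  mod-0⇒∣ : ∀ {q n} → + n ≡ + 0 mod q → q ℕ.∣ n
  mod-0⇒∣ {q} {n} (congruent q∣n-0) = ∣⇒∣ᵤ (subst (+ q ∣_) (ℤ.+-identityʳ (+ n)) q∣n-0)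

open Congruence

module Polynomial where

  open import Data.Integer using (_+_; _*_; _-_)

  ⟦_⟧ : ∀ {n} → Vec ℤ n → ℤ → ℤ
  ⟦ [] ⟧ x = + 0
  ⟦ c ∷ p ⟧ x = c + x * ⟦ p ⟧ x

  monomial : (k : ℕ) → Vec ℤ (suc k)
  monomial zero = + 1 ∷ []
  monomial (suc k) = + 0 ∷ monomial k

  addConstant : ∀ {n} → ℤ → Vec ℤ (suc n) → Vec ℤ (suc n)
  addConstant c (d ∷ p) = c + d ∷ p

  mulByXPlus : ∀ {n} → ℤ → Vec ℤ n → Vec ℤ (suc n)
  mulByXPlus a [] = [ + 0 ]
  mulByXPlus a (c ∷ p) = a * c ∷ addConstant c (mulByXPlus a p)

  translate : ∀ {n} → ℤ → Vec ℤ n → Vec ℤ n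
  translate a [] = []
  translate a (c ∷ p) = addConstant c (mulByXPlus a (translate a p))

  divByXPlus1 : ∀ {n} → Vec ℤ (suc n) → ℤ × Vec ℤ n
  divByXPlus1 (c ∷ []) = c , []
  divByXPlus1 (c ∷ d ∷ p) with divByXPlus1 (d ∷ p)
  ... | r , q = c - r , r ∷ q

  _-ₚ_ : ∀ {n} → Vec ℤ n → Vec ℤ n → Vec ℤ n
  _-ₚ_ = zipWith _-_

  ⟦monomial⟧ : ∀ k n → ⟦ monomial k ⟧ (+ n) ≡ + (n ℕ.^ k)
  ⟦monomial⟧ zero n = cong (λ y → + 1 + y) (ℤ.*-zeroʳ (+ n))
  ⟦monomial⟧ (suc k) n = begin
    + 0 + + n * ⟦ monomial k ⟧ (+ n)  ≡⟨ ℤ.+-identityˡ _ ⟩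
    + n * ⟦ monomial k ⟧ (+ n)        ≡⟨ cong (+ n *_) (⟦monomial⟧ k n) ⟩
    + n * + (n ℕ.^ k)                 ≡⟨ ℤ.pos-* n (n ℕ.^ k) ⟨
    + (n ℕ.^ suc k)                   ∎
    where open ≡-Reasoning

  ⟦addConstant⟧ : ∀ {n} c (p : Vec ℤ (suc n)) x → ⟦ addConstant c p ⟧ x ≡ c + ⟦ p ⟧ x
  ⟦addConstant⟧ c (d ∷ p) x = ℤ.+-assoc c d (x * ⟦ p ⟧ x)

  ⟦mulByXPlus⟧ : ∀ {n} a (p : Vec ℤ n) x → ⟦ mulByXPlus a p ⟧ x ≡ (x + a) * ⟦ p ⟧ x
  ⟦mulByXPlus⟧ a [] x = trans (cong (λ y → + 0 + y) (ℤ.*-zeroʳ x)) (sym (ℤ.*-zeroʳ (x + a)))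
  ⟦mulByXPlus⟧ a (c ∷ p) x = begin
    a * c + x * ⟦ addConstant c (mulByXPlus a p) ⟧ x
      ≡⟨ cong (λ y → a * c + x * y) (⟦addConstant⟧ c (mulByXPlus a p) x) ⟩
    a * c + x * (c + ⟦ mulByXPlus a p ⟧ x)
      ≡⟨ cong (λ y → a * c + x * (c + y)) (⟦mulByXPlus⟧ a p x) ⟩
    a * c + x * (c + (x + a) * ⟦ p ⟧ x)
      ≡⟨ expand a c x (⟦ p ⟧ x) ⟩
    (x + a) * (c + x * ⟦ p ⟧ x)
      ∎
    where
    open ≡-Reasoning
    expand : ∀ a c x q → a * c + x * (c + (x + a) * q) ≡ (x + a) * (c + x * q)
    expand = solve-∀

  ⟦translate⟧ : ∀ {n} a (p : Vec ℤ n) x → ⟦ translate a p ⟧ x ≡ ⟦ p ⟧ (x + a)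
  ⟦translate⟧ a [] x = refl
  ⟦translate⟧ a (c ∷ p) x = begin
    ⟦ addConstant c (mulByXPlus a (translate a p)) ⟧ x  ≡⟨ ⟦addConstant⟧ c (mulByXPlus a (translate a p)) x ⟩
    c + ⟦ mulByXPlus a (translate a p) ⟧ x              ≡⟨ cong (λ y → c + y) (⟦mulByXPlus⟧ a (translate a p) x) ⟩
    c + (x + a) * ⟦ translate a p ⟧ x                   ≡⟨ cong (λ y → c + (x + a) * y) (⟦translate⟧ a p x) ⟩
    c + (x + a) * ⟦ p ⟧ (x + a)                         ∎
    where open ≡-Reasoning

  ⟦divByXPlus1⟧ : ∀ {n} (f : Vec ℤ (suc n)) x →
                  ⟦ f ⟧ x ≡ proj₁ (divByXPlus1 f) + (x + + 1) * ⟦ proj₂ (divByXPlus1 f) ⟧ x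
  ⟦divByXPlus1⟧ (c ∷ []) x = cong (λ y → c + y) (trans (ℤ.*-zeroʳ x) (sym (ℤ.*-zeroʳ (x + + 1))))
  ⟦divByXPlus1⟧ (c ∷ d ∷ p) x with divByXPlus1 (d ∷ p) | ⟦divByXPlus1⟧ (d ∷ p) x
  ... | r , q | g≡r+[x+1]q = trans (cong (λ y → c + x * y) g≡r+[x+1]q) (regroup c x r (⟦ q ⟧ x))
    where
    regroup : ∀ c x r q → c + x * (r + (x + + 1) * q) ≡ (c - r) + (x + + 1) * (r + x * q)
    regroup = solve-∀

  ⟦-ₚ⟧ : ∀ {n} (p q : Vec ℤ n) x → ⟦ p -ₚ q ⟧ x ≡ ⟦ p ⟧ x - ⟦ q ⟧ x
  ⟦-ₚ⟧ [] [] x = refl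
  ⟦-ₚ⟧ (a ∷ p) (b ∷ q) x =
    trans (cong (λ y → a - b + x * y) (⟦-ₚ⟧ p q x)) (regroup a b x (⟦ p ⟧ x) (⟦ q ⟧ x))
    where
    regroup : ∀ a b x u v → (a - b) + x * (u - v) ≡ (a + x * u) - (b + x * v)
    regroup = solve-∀

  ⟦∷ʳ0⟧ : ∀ {n} (p : Vec ℤ n) x → ⟦ p ∷ʳ + 0 ⟧ x ≡ ⟦ p ⟧ x
  ⟦∷ʳ0⟧ [] x = trans (ℤ.+-identityˡ _) (ℤ.*-zeroʳ x)
  ⟦∷ʳ0⟧ (c ∷ p) x = cong (λ y → c + x * y) (⟦∷ʳ0⟧ p x)

  hStep : ∀ {n} → Vec ℤ n → Vec ℤ (suc (suc n))
  hStep h = mulByXPlus (+ 1) (mulByXPlus (+ 2) (translate (+ 2) h)) -ₚ ((h ∷ʳ + 0) ∷ʳ + 0)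

  ⟦hStep⟧ : ∀ {n} (h : Vec ℤ n) x → ⟦ hStep h ⟧ x ≡ (x + + 1) * ((x + + 2) * ⟦ h ⟧ (x + + 2)) - ⟦ h ⟧ x
  ⟦hStep⟧ {n} h x = begin
    ⟦ mulByXPlus (+ 1) [x+2]h[x+2] -ₚ ((h ∷ʳ + 0) ∷ʳ + 0) ⟧ x
      ≡⟨ ⟦-ₚ⟧ (mulByXPlus (+ 1) [x+2]h[x+2]) ((h ∷ʳ + 0) ∷ʳ + 0) x ⟩
    ⟦ mulByXPlus (+ 1) [x+2]h[x+2] ⟧ x - ⟦ (h ∷ʳ + 0) ∷ʳ + 0 ⟧ x
      ≡⟨ cong₂ _-_ (⟦mulByXPlus⟧ (+ 1) [x+2]h[x+2] x) (trans (⟦∷ʳ0⟧ (h ∷ʳ + 0) x) (⟦∷ʳ0⟧ h x)) ⟩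
    (x + + 1) * ⟦ mulByXPlus (+ 2) h[x+2] ⟧ x - ⟦ h ⟧ x
      ≡⟨ cong (λ y → (x + + 1) * y - ⟦ h ⟧ x) (⟦mulByXPlus⟧ (+ 2) h[x+2] x) ⟩
    (x + + 1) * ((x + + 2) * ⟦ h[x+2] ⟧ x) - ⟦ h ⟧ x
      ≡⟨ cong (λ y → (x + + 1) * ((x + + 2) * y) - ⟦ h ⟧ x) (⟦translate⟧ (+ 2) h x) ⟩
    (x + + 1) * ((x + + 2) * ⟦ h ⟧ (x + + 2)) - ⟦ h ⟧ x
      ∎
    where
    open ≡-Reasoning
    h[x+2] : Vec ℤ n
    h[x+2] = translate (+ 2) h
    [x+2]h[x+2] : Vec ℤ (suc n)
    [x+2]h[x+2] = mulByXPlus (+ 2) h[x+2]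

  H-length : ℕ → ℕ
  H-length zero = 1
  H-length (suc r) = suc (suc (H-length r))

  H : (r : ℕ) → Vec ℤ (H-length r)
  H zero = [ + 1 ]
  H (suc r) = hStep (H r)

  translate-−2-difference-even : ∀ {n} (g : Vec ℤ n) →
                                ∃ λ (d : Vec ℤ n) → ∀ x → ⟦ g ⟧ (x - + 2) - ⟦ g ⟧ x ≡ + 2 * ⟦ d ⟧ x
  translate-−2-difference-even [] = [] , λ x → refl
  translate-−2-difference-even (c ∷ g) with translate-−2-difference-even g
  ... | d , even = (+ 0 ∷ d) -ₚ (translate (- + 2) g ∷ʳ + 0) , λ x → begin
    (c + (x - + 2) * ⟦ g ⟧ (x - + 2)) - (c + x * ⟦ g ⟧ x)
      ≡⟨ regroup c x (⟦ g ⟧ (x - + 2)) (⟦ g ⟧ x) ⟩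
    x * (⟦ g ⟧ (x - + 2) - ⟦ g ⟧ x) - + 2 * ⟦ g ⟧ (x - + 2)
      ≡⟨ cong (λ y → x * y - + 2 * ⟦ g ⟧ (x - + 2)) (even x) ⟩
    x * (+ 2 * ⟦ d ⟧ x) - + 2 * ⟦ g ⟧ (x - + 2)
      ≡⟨ factor x (⟦ d ⟧ x) (⟦ g ⟧ (x - + 2)) ⟩
    + 2 * ((+ 0 + x * ⟦ d ⟧ x) - ⟦ g ⟧ (x - + 2))
      ≡⟨ cong (λ y → + 2 * ((+ 0 + x * ⟦ d ⟧ x) - y))
              (sym (trans (⟦∷ʳ0⟧ (translate (- + 2) g) x) (⟦translate⟧ (- + 2) g x))) ⟩
    + 2 * (⟦ + 0 ∷ d ⟧ x - ⟦ translate (- + 2) g ∷ʳ + 0 ⟧ x)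
      ≡⟨ cong (+ 2 *_) (sym (⟦-ₚ⟧ (+ 0 ∷ d) (translate (- + 2) g ∷ʳ + 0) x)) ⟩
    + 2 * ⟦ (+ 0 ∷ d) -ₚ (translate (- + 2) g ∷ʳ + 0) ⟧ x
      ∎
    where
    open ≡-Reasoning
    regroup : ∀ c x u v → (c + (x - + 2) * u) - (c + x * v) ≡ x * (u - v) - + 2 * u
    regroup = solve-∀
    factor : ∀ x e u → x * (+ 2 * e) - + 2 * u ≡ + 2 * ((+ 0 + x * e) - u)
    factor = solve-∀

open Polynomial

module Combination where

  open import Data.Integer using (_+_; _*_; _-_)

  combination : ∀ {n} → Vec ℤ n → (ℕ → ℤ) → ℕ → ℤ
  combination [] s k = + 0
  combination (c ∷ cs) s k = c * s k + combination cs s (suc k)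

  combination-∷ʳ : ∀ {n} (h : Vec ℤ n) x s k → combination (h ∷ʳ x) s k ≡ combination h s k + x * s (n ℕ.+ k)
  combination-∷ʳ [] x s k = trans (ℤ.+-identityʳ (x * s k)) (sym (ℤ.+-identityˡ (x * s k)))
  combination-∷ʳ {suc n} (c ∷ h) x s k = begin
    c * s k + combination (h ∷ʳ x) s (suc k)
      ≡⟨ cong (λ y → c * s k + y) (combination-∷ʳ h x s (suc k)) ⟩
    c * s k + (combination h s (suc k) + x * s (n ℕ.+ suc k))
      ≡⟨ cong (λ i → c * s k + (combination h s (suc k) + x * s i)) (ℕ.+-suc n k) ⟩
    c * s k + (combination h s (suc k) + x * s (suc n ℕ.+ k))
      ≡⟨ ℤ.+-assoc (c * s k) _ _ ⟨
    c * s k + combination h s (suc k) + x * s (suc n ℕ.+ k)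
      ∎
    where open ≡-Reasoning

  combination-negate-% : ∀ {n} q .{{_ : NonZero q}} (h : Vec ℤ n) s k →
                         combination (map +_ (map (λ a → (- a) ℤ.%ℕ q) h)) s k ≡ - combination h s k mod q
  combination-negate-% q [] s k = mod-refl
  combination-negate-% q (c ∷ h) s k =
    mod-trans (+-mod-cong (*-mod-congʳ (s k) (%ℕ-mod q (- c))) (combination-negate-% q h s (suc k)))
              (mod-reflexive (negate c (s k) (combination h s (suc k))))
    where
    negate : ∀ c x y → (- c) * x + - y ≡ - (c * x + y)
    negate = solve-∀

  combination-init-last : ∀ {n} (h : Vec ℤ (suc n)) s k →
                          combination h s k ≡ combination (init h) s k + last h * s (n ℕ.+ k)
  combination-init-last {n} h s k with initLast h
  ... | h′ , x , refl = combination-∷ʳ h′ x s k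

  monic-recurrence : ∀ {n} q .{{_ : NonZero q}} (h : Vec ℤ (suc n)) s → last h ≡ + 1 →
                     (∀ k → combination h s k ≡ + 0 mod q) →
                     ∀ k → s (n ℕ.+ k) ≡ combination (map +_ (map (λ a → (- a) ℤ.%ℕ q) (init h))) s k mod q
  monic-recurrence {n} q h s monic vanishes k = begin
    s (n ℕ.+ k)                                     ≡⟨ add-cancel (combination (init h) s k) (s (n ℕ.+ k)) ⟩
    (combination (init h) s k + + 1 * s (n ℕ.+ k)) - combination (init h) s k
      ≡⟨ cong (λ x → (combination (init h) s k + x * s (n ℕ.+ k)) - combination (init h) s k) (sym monic) ⟩
    (combination (init h) s k + last h * s (n ℕ.+ k)) - combination (init h) s k
      ≡⟨ cong (_- combination (init h) s k) (sym (combination-init-last h s k)) ⟩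
    combination h s k - combination (init h) s k    ≈⟨ −-mod-cong (vanishes k) mod-refl ⟩
    + 0 - combination (init h) s k                  ≡⟨ ℤ.+-identityˡ _ ⟩
    - combination (init h) s k                      ≈⟨ mod-sym (combination-negate-% q (init h) s k) ⟩
    combination (map +_ (map (λ a → (- a) ℤ.%ℕ q) (init h))) s k ∎
    where
    open mod-Reasoning q
    add-cancel : ∀ c y → y ≡ (c + + 1 * y) - c
    add-cancel = solve-∀

open Combination

module FactorialSeries where

  open import Data.Integer using (_+_; _*_; _-_)

  partialSum-cong : ∀ {t u : ℕ → ℤ} → (∀ n → t n ≡ u n) → ∀ N → partialSum t N ≡ partialSum u N
  partialSum-cong t≗u zero = refl
  partialSum-cong t≗u (suc N) = cong₂ _+_ (partialSum-cong t≗u N) (t≗u (suc N))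

  partialSum-+ : ∀ (t u : ℕ → ℤ) N → partialSum (λ n → t n + u n) N ≡ partialSum t N + partialSum u N
  partialSum-+ t u zero = refl
  partialSum-+ t u (suc N) = trans (cong (_+ (t (suc N) + u (suc N))) (partialSum-+ t u N))
                                   (regroup (partialSum t N) (partialSum u N) (t (suc N)) (u (suc N)))
    where
    regroup : ∀ a b c d → (a + b) + (c + d) ≡ (a + c) + (b + d)
    regroup = solve-∀

  partialSum-− : ∀ (t u : ℕ → ℤ) N → partialSum (λ n → t n - u n) N ≡ partialSum t N - partialSum u N
  partialSum-− t u zero = refl
  partialSum-− t u (suc N) = trans (cong (_+ (t (suc N) - u (suc N))) (partialSum-− t u N))
                                   (regroup (partialSum t N) (partialSum u N) (t (suc N)) (u (suc N)))
    where
    regroup : ∀ a b c d → (a - b) + (c - d) ≡ (a + c) - (b + d)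
    regroup = solve-∀

  partialSum-* : ∀ c (t : ℕ → ℤ) N → partialSum (λ n → c * t n) N ≡ c * partialSum t N
  partialSum-* c t zero = sym (ℤ.*-zeroʳ c)
  partialSum-* c t (suc N) = trans (cong (_+ c * t (suc N)) (partialSum-* c t N))
                                   (sym (ℤ.*-distribˡ-+ c (partialSum t N) (t (suc N))))

  factorialSum : (ℤ → ℤ) → ℕ → ℤ
  factorialSum f = partialSum (λ n → f (+ n) * + (n !))

  factorialSum-cong : ∀ {f g} → (∀ x → f x ≡ g x) → ∀ N → factorialSum f N ≡ factorialSum g N
  factorialSum-cong f≗g = partialSum-cong (λ n → cong (_* + (n !)) (f≗g (+ n)))

  factorialSum-+ : ∀ f g N → factorialSum (λ x → f x + g x) N ≡ factorialSum f N + factorialSum g N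
  factorialSum-+ f g N = trans (partialSum-cong (λ n → ℤ.*-distribʳ-+ (+ (n !)) (f (+ n)) (g (+ n))) N)
                               (partialSum-+ _ _ N)

  factorialSum-− : ∀ f g N → factorialSum (λ x → f x - g x) N ≡ factorialSum f N - factorialSum g N
  factorialSum-− f g N = trans (partialSum-cong (λ n → [y-z]x≈yx-zx (+ (n !)) (f (+ n)) (g (+ n))) N)
                               (partialSum-− _ _ N)

  factorialSum-* : ∀ c f N → factorialSum (λ x → c * f x) N ≡ c * factorialSum f N
  factorialSum-* c f N = trans (partialSum-cong (λ n → ℤ.*-assoc c (f (+ n)) (+ (n !))) N)
                               (partialSum-* c _ N)

  -- Σ f(n) n! = A + B α, in the strong sense that the partial sums agree modulo N!.
  record Expansion (f : ℤ → ℤ) (A B : ℤ) : Set where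
    constructor expansion
    field congruence : ∀ N → factorialSum f N ≡ A + B * partialSum αTerm N mod (N !)

  module _ {f g : ℤ → ℤ} where

    Expansion-cong : ∀ {A B} → (∀ x → f x ≡ g x) → Expansion f A B → Expansion g A B
    Expansion-cong f≗g (expansion e) = expansion λ N →
      mod-trans (mod-reflexive (sym (factorialSum-cong f≗g N))) (e N)

    Expansion-+ : ∀ {A B A′ B′} → Expansion f A B → Expansion g A′ B′ →
                  Expansion (λ x → f x + g x) (A + A′) (B + B′)
    Expansion-+ {A} {B} {A′} {B′} (expansion e) (expansion e′) = expansion summed
      where
      regroup : ∀ a b a′ b′ s → (a + b * s) + (a′ + b′ * s) ≡ (a + a′) + (b + b′) * s
      regroup = solve-∀
      summed : ∀ N → factorialSum (λ x → f x + g x) N ≡ (A + A′) + (B + B′) * partialSum αTerm N mod (N !)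
      summed N = begin
        factorialSum (λ x → f x + g x) N                              ≡⟨ factorialSum-+ f g N ⟩
        factorialSum f N + factorialSum g N                          ≈⟨ +-mod-cong (e N) (e′ N) ⟩
        (A + B * partialSum αTerm N) + (A′ + B′ * partialSum αTerm N) ≡⟨ regroup A B A′ B′ _ ⟩
        (A + A′) + (B + B′) * partialSum αTerm N                      ∎
        where open mod-Reasoning (N !)

    Expansion-− : ∀ {A B A′ B′} → Expansion f A B → Expansion g A′ B′ →
                  Expansion (λ x → f x - g x) (A - A′) (B - B′)
    Expansion-− {A} {B} {A′} {B′} (expansion e) (expansion e′) = expansion difference
      where
      regroup : ∀ a b a′ b′ s → (a + b * s) - (a′ + b′ * s) ≡ (a - a′) + (b - b′) * s
      regroup = solve-∀
      difference : ∀ N → factorialSum (λ x → f x - g x) N ≡ (A - A′) + (B - B′) * partialSum αTerm N mod (N !)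
      difference N = begin
        factorialSum (λ x → f x - g x) N                              ≡⟨ factorialSum-− f g N ⟩
        factorialSum f N - factorialSum g N                          ≈⟨ −-mod-cong (e N) (e′ N) ⟩
        (A + B * partialSum αTerm N) - (A′ + B′ * partialSum αTerm N) ≡⟨ regroup A B A′ B′ _ ⟩
        (A - A′) + (B - B′) * partialSum αTerm N                      ∎
        where open mod-Reasoning (N !)

  Expansion-* : ∀ {f A B} c → Expansion f A B → Expansion (λ x → c * f x) (c * A) (c * B)
  Expansion-* {f} {A} {B} c (expansion e) = expansion scaled
    where
    regroup : ∀ c a b s → c * (a + b * s) ≡ c * a + (c * b) * s
    regroup = solve-∀
    scaled : ∀ N → factorialSum (λ x → c * f x) N ≡ c * A + (c * B) * partialSum αTerm N mod (N !)
    scaled N = begin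
      factorialSum (λ x → c * f x) N     ≡⟨ factorialSum-* c f N ⟩
      c * factorialSum f N               ≈⟨ *-mod-congˡ c (e N) ⟩
      c * (A + B * partialSum αTerm N)   ≡⟨ regroup c A B _ ⟩
      c * A + (c * B) * partialSum αTerm N ∎
      where open mod-Reasoning (N !)

  Expansion-const : ∀ c → Expansion (λ _ → c) (+ 0) c
  Expansion-const c = expansion λ N → mod-reflexive (trans (partialSum-* c αTerm N) (sym (ℤ.+-identityˡ _)))

  -- (n + 1) g(n) n! = g(n) (n + 1)!
  factorialSum-telescope : ∀ (g : ℤ → ℤ) N → factorialSum (λ x → (x + + 1) * g x) N ≡
                           factorialSum (λ x → g (x - + 1)) N - g (+ 0) + g (+ N) * + (suc N !)
  factorialSum-telescope g zero = base (g (+ 0))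
    where
    base : ∀ a → + 0 ≡ + 0 - a + a * + 1
    base = solve-∀
  factorialSum-telescope g (suc N) = begin
    factorialSum F N + (+ suc N + + 1) * g (+ suc N) * + (suc N !)
      ≡⟨ cong (_+ (+ suc N + + 1) * g (+ suc N) * + (suc N !)) (factorialSum-telescope g N) ⟩
    (factorialSum G N - g (+ 0) + g (+ N) * + (suc N !)) + (+ suc N + + 1) * g (+ suc N) * + (suc N !)
      ≡⟨ regroup (factorialSum G N) (g (+ 0)) (g (+ N)) (g (+ suc N)) (+ (suc N !)) (+ suc N + + 1) ⟩
    (factorialSum G N + g (+ N) * + (suc N !)) - g (+ 0) + g (+ suc N) * ((+ suc N + + 1) * + (suc N !))
      ≡⟨ cong (λ y → (factorialSum G N + g (+ N) * + (suc N !)) - g (+ 0) + g (+ suc N) * y) factorial-step ⟩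
    (factorialSum G N + g (+ N) * + (suc N !)) - g (+ 0) + g (+ suc N) * + (suc (suc N) !)
      ∎
    where
    open ≡-Reasoning
    F G : ℤ → ℤ
    F x = (x + + 1) * g x
    G x = g (x - + 1)
    regroup : ∀ s a b c f n → (s - a + b * f) + n * c * f ≡ (s + b * f) - a + c * (n * f)
    regroup = solve-∀
    factorial-step : (+ suc N + + 1) * + (suc N !) ≡ + (suc (suc N) !)
    factorial-step = trans (sym (ℤ.pos-* (suc N ℕ.+ 1) (suc N !)))
                           (cong (λ n → + (n ℕ.* suc N !)) (ℕ.+-comm (suc N) 1))

  Expansion-telescope : ∀ (g : ℤ → ℤ) {A B} → Expansion (λ x → g (x - + 1)) A B →
                        Expansion (λ x → (x + + 1) * g x) (A - g (+ 0)) B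
  Expansion-telescope g {A} {B} (expansion e) = expansion telescoped
    where
    regroup : ∀ a b s c → (a + b * s) - c ≡ (a - c) + b * s
    regroup = solve-∀
    telescoped : ∀ N → factorialSum (λ x → (x + + 1) * g x) N ≡ (A - g (+ 0)) + B * partialSum αTerm N mod (N !)
    telescoped N = begin
      factorialSum (λ x → (x + + 1) * g x) N
        ≡⟨ factorialSum-telescope g N ⟩
      factorialSum G N - g (+ 0) + g (+ N) * + (suc N !)
        ≡⟨ cong (λ y → factorialSum G N - g (+ 0) + y) (trans (cong (g (+ N) *_) (ℤ.pos-* (suc N) (N !)))
                                                      (sym (ℤ.*-assoc (g (+ N)) (+ suc N) (+ (N !))))) ⟩
      factorialSum G N - g (+ 0) + (g (+ N) * + suc N) * + (N !)
        ≈⟨ mod-+-multiple _ (g (+ N) * + suc N) ⟩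
      factorialSum G N - g (+ 0)
        ≈⟨ −-mod-cong (e N) mod-refl ⟩
      (A + B * partialSum αTerm N) - g (+ 0)
        ≡⟨ regroup A B _ (g (+ 0)) ⟩
      (A - g (+ 0)) + B * partialSum αTerm N
        ∎
      where
      open mod-Reasoning (N !)
      G : ℤ → ℤ
      G x = g (x - + 1)

  αCoefficient : ∀ {n} → Vec ℤ n → ℤ
  αCoefficient [] = + 0
  αCoefficient (c ∷ p) with divByXPlus1 (c ∷ p)
  ... | r , q = r + αCoefficient (translate (- + 1) q)

  expansionOf : ∀ {n} (p : Vec ℤ n) → ∃ λ A → Expansion ⟦ p ⟧ A (αCoefficient p)
  expansionOf [] = + 0 , Expansion-const (+ 0)
  expansionOf (c ∷ p) with divByXPlus1 (c ∷ p) | ⟦divByXPlus1⟧ (c ∷ p)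
  ... | r , q | f≡r+[x+1]q with expansionOf (translate (- + 1) q)
  ...   | A , e = _ , Expansion-cong (λ x → sym (f≡r+[x+1]q x))
                     (Expansion-+ (Expansion-const r)
                       (Expansion-telescope ⟦ q ⟧ (Expansion-cong (⟦translate⟧ (- + 1) q) e)))

  β : ℕ → ℤ
  β k = αCoefficient (monomial k)

  expansion-combination : ∀ {n} (h : Vec ℤ n) k →
                          ∃ λ A → Expansion (λ x → ⟦ h ⟧ x * ⟦ monomial k ⟧ x) A (combination h β k)
  expansion-combination [] k = + 0 , Expansion-cong (λ x → sym (ℤ.*-zeroˡ (⟦ monomial k ⟧ x))) (Expansion-const (+ 0))
  expansion-combination (c ∷ h) k with expansionOf (monomial k) | expansion-combination h (suc k)
  ... | _ , e | _ , e′ =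
    _ , Expansion-cong (λ x → distribute c x (⟦ h ⟧ x) (⟦ monomial k ⟧ x)) (Expansion-+ (Expansion-* c e) e′)
    where
    distribute : ∀ c x v w → c * w + v * (+ 0 + x * w) ≡ (c + x * v) * w
    distribute = solve-∀

  αkTerm-monomial : ∀ k n → αkTerm k n ≡ ⟦ monomial k ⟧ (+ n) * + (n !)
  αkTerm-monomial k n = trans (ℤ.pos-* (n ℕ.^ k) (n !)) (cong (_* + (n !)) (sym (⟦monomial⟧ k n)))

  m≤n⇒m∣n! : ∀ {m n} .{{_ : NonZero m}} → m ℕ.≤ n → m ℕ.∣ n !
  m≤n⇒m∣n! {suc m} m≤n = ℕ.∣-trans (ℕ.divides (m !) (ℕ.*-comm (suc m) (m !))) (ℕ.m≤n⇒m!∣n! m≤n)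

  pos-^ : ∀ p m → (+ p) ℤ.^ m ≡ + (p ℕ.^ m)
  pos-^ p zero = refl
  pos-^ p (suc m) = trans (cong (λ y → + p * y) (pos-^ p m)) (sym (ℤ.pos-* p (p ℕ.^ m)))

  SeriesIsRational-cong : ∀ {p t u} → (∀ n → t n ≡ u n) → SeriesIsRational p t → SeriesIsRational p u
  SeriesIsRational-cong {p} t≗u (a , b , b≢0 , t→a/b) = a , b , b≢0 , λ m →
    let N , tail = t→a/b m in
    N , λ N′ N≤N′ → subst (λ s → (+ p) ℤ.^ m ∣ᵤ b * s - a) (partialSum-cong t≗u N′) (tail N′ N≤N′)

  module _ (p : ℕ) .{{_ : NonZero p}} where

    p^m∣ᵤ⇒mod : ∀ m {x y} → (+ p) ℤ.^ m ∣ᵤ x - y → x ≡ y mod (p ℕ.^ m)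
    p^m∣ᵤ⇒mod m {x} {y} p^m∣x-y = congruent (∣ᵤ⇒∣ (subst (_∣ᵤ x - y) (pos-^ p m) p^m∣x-y))

    mod⇒p^m∣ᵤ : ∀ m {x y} → x ≡ y mod (p ℕ.^ m) → (+ p) ℤ.^ m ∣ᵤ x - y
    mod⇒p^m∣ᵤ m {x} {y} (congruent p^m∣x-y) = subst (_∣ᵤ x - y) (sym (pos-^ p m)) (∣⇒∣ᵤ p^m∣x-y)

    p^m∣n! : ∀ m {n} → p ℕ.^ m ℕ.≤ n → p ℕ.^ m ℕ.∣ n !
    p^m∣n! m = m≤n⇒m∣n! {{ℕ.m^n≢0 p m}}

    factorial-rate⇒seriesEqualsRational : ∀ {t a b} → (∀ N → b * partialSum t N ≡ a mod (N !)) →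
                                          SeriesEqualsRational p t a b
    factorial-rate⇒seriesEqualsRational factorial-rate m = p ℕ.^ m , λ N p^m≤N →
      mod⇒p^m∣ᵤ m (mod-weaken (p^m∣n! m p^m≤N) (factorial-rate N))

    module _ (α-irrational : ¬ SeriesIsRational p αTerm) where

      expansion-unique : ∀ {f A B A′ B′} → Expansion f A B → Expansion f A′ B′ → B ≡ B′
      expansion-unique {_} {A} {B} {A′} {B′} (expansion e) (expansion e′) with B ℤ.≟ B′
      ... | yes B≡B′ = B≡B′
      ... | no B≢B′ = contradiction
        (A - A′ , B′ - B , B′-B≢0 , factorial-rate⇒seriesEqualsRational {αTerm} {A - A′} {B′ - B} congruent-α)
        α-irrational
        where
        B′-B≢0 : B′ - B ≢ + 0
        B′-B≢0 B′-B≡0 = B≢B′ (sym (ℤ.i-j≡0⇒i≡j B′ B B′-B≡0))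
        regroup : ∀ a b a′ b′ s → (b′ - b) * s ≡ ((a′ + b′ * s) - (a + b * s)) + (a - a′)
        regroup = solve-∀
        cancel : ∀ x c → (x - x) + c ≡ c
        cancel = solve-∀
        congruent-α : ∀ N → (B′ - B) * partialSum αTerm N ≡ A - A′ mod (N !)
        congruent-α N = begin
          (B′ - B) * σ                               ≡⟨ regroup A B A′ B′ σ ⟩
          ((A′ + B′ * σ) - (A + B * σ)) + (A - A′)
            ≈⟨ +-mod-cong (−-mod-cong (mod-trans (mod-sym (e′ N)) (e N)) mod-refl) mod-refl ⟩
          ((A + B * σ) - (A + B * σ)) + (A - A′)     ≡⟨ cancel (A + B * σ) (A - A′) ⟩
          A - A′                                     ∎
          where
          open mod-Reasoning (N !)
          σ : ℤ
          σ = partialSum αTerm N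

      expansion-irrational : ∀ {f A B} → Expansion f A B → B ≢ + 0 →
                             ¬ SeriesIsRational p (λ n → f (+ n) * + (n !))
      expansion-irrational {f} {A} {B} (expansion e) B≢0 (a , b , b≢0 , f→a/b) =
        α-irrational (a - b * A , b * B , bB≢0 , α→ )
        where
        bB≢0 : b * B ≢ + 0
        bB≢0 bB≡0 = [ b≢0 , B≢0 ]′ (ℤ.i*j≡0⇒i≡0∨j≡0 b bB≡0)
        regroup : ∀ a b c s → (b * c) * s ≡ b * (a + c * s) - b * a
        regroup = solve-∀
        α→ : SeriesEqualsRational p αTerm (a - b * A) (b * B)
        α→ m with f→a/b m
        ... | N₀ , tail = N₀ ℕ.⊔ p ℕ.^ m , congruent-α
          where
          congruent-α : ∀ N → N₀ ℕ.⊔ p ℕ.^ m ℕ.≤ N → (+ p) ℤ.^ m ∣ᵤ (b * B) * partialSum αTerm N - (a - b * A)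
          congruent-α N N₀⊔p^m≤N = mod⇒p^m∣ᵤ m (begin
            (b * B) * partialSum αTerm N              ≡⟨ regroup A b B _ ⟩
            b * (A + B * partialSum αTerm N) - b * A
              ≈⟨ −-mod-cong (*-mod-congˡ b (mod-sym (mod-weaken (p^m∣n! m p^m≤N) (e N)))) mod-refl ⟩
            b * factorialSum f N - b * A
              ≈⟨ −-mod-cong (p^m∣ᵤ⇒mod m {b * factorialSum f N} {a} (tail N N₀≤N)) mod-refl ⟩
            a - b * A                                  ∎)
            where
            open mod-Reasoning (p ℕ.^ m)
            N₀≤N : N₀ ℕ.≤ N
            N₀≤N = ℕ.m⊔n≤o⇒m≤o N₀ _ N₀⊔p^m≤N
            p^m≤N : p ℕ.^ m ℕ.≤ N
            p^m≤N = ℕ.m⊔n≤o⇒n≤o N₀ _ N₀⊔p^m≤N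

      H-multiple-expansion : ∀ r {n} (g : Vec ℤ n) →
                             ∃ λ A → ∃ λ B → Expansion (λ x → ⟦ H r ⟧ x * ⟦ g ⟧ x) A B × + (2 ℕ.^ r) ∣ B
      H-multiple-expansion zero g with expansionOf g
      ... | A , e = A , αCoefficient g , Expansion-cong (λ x → sym (one-times x (⟦ g ⟧ x))) e ,
                    divides (αCoefficient g) (sym (ℤ.*-identityʳ _))
        where
        one-times : ∀ x y → (+ 1 + x * + 0) * y ≡ y
        one-times = solve-∀
      H-multiple-expansion (suc r) g
        with H-multiple-expansion r (translate (- + 2) g) | H-multiple-expansion r g | translate-−2-difference-even g
      ... | _ , B₂ , e₂ , _ | _ , B₁ , e₁ , _ | d , even with H-multiple-expansion r d
      ... | _ , B₃ , e₃ , 2^r∣B₃ = _ , B₂ - B₁ , expansion-H-suc , 2^[1+r]∣B₂-B₁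
        where
        h G : ℤ → ℤ
        h = ⟦ H r ⟧
        G = ⟦ g ⟧

        x≡x-1+1 : ∀ x → x ≡ x - + 1 + + 1
        x≡x-1+1 = solve-∀
        x-2≡x-1-1 : ∀ x → x - + 2 ≡ x - + 1 - + 1
        x-2≡x-1-1 = solve-∀
        x+1≡x-1+2 : ∀ x → x + + 1 ≡ x - + 1 + + 2
        x+1≡x-1+2 = solve-∀

        once : Expansion (λ x → (x + + 1) * (h (x + + 1) * G (x - + 1))) _ B₂
        once = Expansion-telescope (λ x → h (x + + 1) * G (x - + 1)) (Expansion-cong shifted e₂)
          where
          shifted : ∀ x → h x * ⟦ translate (- + 2) g ⟧ x ≡ h (x - + 1 + + 1) * G (x - + 1 - + 1)
          shifted x = cong₂ _*_ (cong h (x≡x-1+1 x)) (trans (⟦translate⟧ (- + 2) g x) (cong G (x-2≡x-1-1 x)))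

        twice : Expansion (λ x → (x + + 1) * ((x + + 2) * (h (x + + 2) * G x))) _ B₂
        twice = Expansion-telescope (λ x → (x + + 2) * (h (x + + 2) * G x)) (Expansion-cong shifted once)
          where
          shifted : ∀ x → (x + + 1) * (h (x + + 1) * G (x - + 1)) ≡
                          (x - + 1 + + 2) * (h (x - + 1 + + 2) * G (x - + 1))
          shifted x = cong (λ y → y * (h y * G (x - + 1))) (x+1≡x-1+2 x)

        expansion-H-suc : Expansion (λ x → ⟦ H (suc r) ⟧ x * G x) _ (B₂ - B₁)
        expansion-H-suc = Expansion-cong (λ x → trans (factor x (h (x + + 2)) (h x) (G x))
                                                      (cong (_* G x) (sym (⟦hStep⟧ (H r) x))))
                                         (Expansion-− twice e₁)
          where
          factor : ∀ x u v w → (x + + 1) * ((x + + 2) * (u * w)) - v * w ≡ ((x + + 1) * ((x + + 2) * u) - v) * w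
          factor = solve-∀

        B₂-B₁≡2B₃ : B₂ - B₁ ≡ + 2 * B₃
        B₂-B₁≡2B₃ = expansion-unique (Expansion-− e₂ e₁) (Expansion-cong doubled (Expansion-* (+ 2) e₃))
          where
          doubled : ∀ x → + 2 * (h x * ⟦ d ⟧ x) ≡ h x * ⟦ translate (- + 2) g ⟧ x - h x * G x
          doubled x = begin
            + 2 * (h x * ⟦ d ⟧ x)              ≡⟨ commute (h x) (⟦ d ⟧ x) ⟩
            h x * (+ 2 * ⟦ d ⟧ x)              ≡⟨ cong (h x *_) (sym (even x)) ⟩
            h x * (G (x - + 2) - G x)          ≡⟨ x[y-z]≈xy-xz (h x) (G (x - + 2)) (G x) ⟩
            h x * G (x - + 2) - h x * G x      ≡⟨ cong (λ y → h x * y - h x * G x) (sym (⟦translate⟧ (- + 2) g x)) ⟩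
            h x * ⟦ translate (- + 2) g ⟧ x - h x * G x ∎
            where
            open ≡-Reasoning
            commute : ∀ a b → + 2 * (a * b) ≡ a * (+ 2 * b)
            commute = solve-∀

        2^[1+r]∣B₂-B₁ : + (2 ℕ.^ suc r) ∣ B₂ - B₁
        2^[1+r]∣B₂-B₁ =
          subst₂ _∣_ (sym (ℤ.pos-* 2 (2 ℕ.^ r))) (sym B₂-B₁≡2B₃) (*-monoʳ-∣ (+ 2) 2^r∣B₃)

      2^r∣combination-H-β : ∀ r k → + (2 ℕ.^ r) ∣ combination (H r) β k
      2^r∣combination-H-β r k with H-multiple-expansion r (monomial k) | expansion-combination (H r) k
      ... | _ , _ , e , 2^r∣B | _ , e′ = subst (+ (2 ℕ.^ r) ∣_) (expansion-unique e e′) 2^r∣B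

open FactorialSeries

module LinearRecurrence (m : ℕ) .{{_ : NonZero m}} {d : ℕ} (coefficients : Vec ℕ (suc d)) (s : ℕ → ℤ) where

  open import Data.Integer using (_+_; _*_; _-_)

  ⟪_⟫ : ∀ {n} → Vec ℕ n → ℕ → ℤ
  ⟪ r ⟫ = combination (map +_ r) s

  ⟪⟫-+ : ∀ {n} (u w : Vec ℕ n) k → ⟪ zipWith ℕ._+_ u w ⟫ k ≡ ⟪ u ⟫ k + ⟪ w ⟫ k
  ⟪⟫-+ [] [] k = sym (ℤ.+-identityˡ (+ 0))
  ⟪⟫-+ (a ∷ u) (b ∷ w) k =
    trans (cong₂ (λ x y → x * s k + y) (ℤ.pos-+ a b) (⟪⟫-+ u w (suc k)))
          (regroup (+ a) (+ b) (s k) (⟪ u ⟫ (suc k)) (⟪ w ⟫ (suc k)))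
    where
    regroup : ∀ a b x u w → (a + b) * x + (u + w) ≡ (a * x + u) + (b * x + w)
    regroup = solve-∀

  ⟪⟫-* : ∀ {n} a (u : Vec ℕ n) k → ⟪ map (a ℕ.*_) u ⟫ k ≡ + a * ⟪ u ⟫ k
  ⟪⟫-* a [] k = sym (ℤ.*-zeroʳ (+ a))
  ⟪⟫-* a (b ∷ u) k =
    trans (cong₂ (λ x y → x * s k + y) (ℤ.pos-* a b) (⟪⟫-* a u (suc k)))
          (regroup (+ a) (+ b) (s k) (⟪ u ⟫ (suc k)))
    where
    regroup : ∀ a b x u → (a * b) * x + a * u ≡ a * (b * x + u)
    regroup = solve-∀

  ⟪⟫-replicate-0 : ∀ n k → ⟪ replicate n 0 ⟫ k ≡ + 0
  ⟪⟫-replicate-0 zero k = refl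
  ⟪⟫-replicate-0 (suc n) k = trans (ℤ.+-identityˡ _) (⟪⟫-replicate-0 n (suc k))

  ⟪⟫-% : ∀ {n} (u : Vec ℕ n) k → ⟪ map (ℕ._% m) u ⟫ k ≡ ⟪ u ⟫ k mod m
  ⟪⟫-% [] k = mod-refl
  ⟪⟫-% (a ∷ u) k = +-mod-cong (*-mod-congʳ (s k) (%ℕ-mod m (+ a))) (⟪⟫-% u (suc k))

  ⟪⟫-agree : ∀ {q n} (r : Vec ℕ n) T k → (∀ i → i ℕ.< n → s (T ℕ.+ (k ℕ.+ i)) ≡ s (k ℕ.+ i) mod q) →
             ⟪ r ⟫ (T ℕ.+ k) ≡ ⟪ r ⟫ k mod q
  ⟪⟫-agree [] T k agree = mod-refl
  ⟪⟫-agree {q} (a ∷ r) T k agree = +-mod-cong (*-mod-congˡ (+ a) head-agrees) tail-agrees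
    where
    head-agrees : s (T ℕ.+ k) ≡ s k mod q
    head-agrees = subst₂ (λ i j → s (T ℕ.+ i) ≡ s j mod q) (ℕ.+-identityʳ k) (ℕ.+-identityʳ k)
                         (agree 0 (ℕ.s≤s ℕ.z≤n))
    tail-agrees : ⟪ r ⟫ (suc (T ℕ.+ k)) ≡ ⟪ r ⟫ (suc k) mod q
    tail-agrees = subst (λ i → ⟪ r ⟫ i ≡ ⟪ r ⟫ (suc k) mod q) (ℕ.+-suc T k)
      (⟪⟫-agree r T (suc k) λ i i<n →
        subst (λ j → s (T ℕ.+ j) ≡ s j mod q) (ℕ.+-suc k i) (agree (suc i) (ℕ.s≤s i<n)))

  Matrix : ℕ → Set
  Matrix n = Vec (Vec ℕ (suc d)) n

  lincomb : ∀ {n} → Vec ℕ n → Matrix n → Vec ℕ (suc d)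
  lincomb [] [] = replicate _ 0
  lincomb (a ∷ r) (row ∷ A) = zipWith ℕ._+_ (map (a ℕ.*_) row) (lincomb r A)

  _⊗_ : ∀ {n} → Matrix n → Matrix (suc d) → Matrix n
  B ⊗ A = map (λ r → map (ℕ._% m) (lincomb r A)) B

  apply : ∀ {n} → Matrix n → Vec ℕ (suc d) → Vec ℕ n
  apply A v = map (λ r → sum (zipWith ℕ._*_ r v) ℕ.% m) A

  unit : ℕ → (n : ℕ) → Vec ℕ n
  unit j zero = []
  unit zero (suc n) = 1 ∷ replicate n 0
  unit (suc j) (suc n) = 0 ∷ unit j n

  units : ℕ → (n : ℕ) → Matrix n
  units j zero = []
  units j (suc n) = unit j (suc d) ∷ units (suc j) n

  companion : Matrix (suc d)
  companion = units 1 d ∷ʳ coefficients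

  power : ℕ → Matrix (suc d)
  power zero = units 0 (suc d)
  power (suc n) = companion ⊗ power n

  window : ℕ → (n : ℕ) → Vec ℕ n
  window k zero = []
  window k (suc n) = s k ℤ.%ℕ m ∷ window (suc k) n

  RowShifts : Vec ℕ (suc d) → ℕ → Set
  RowShifts r j = ∀ k → ⟪ r ⟫ k ≡ s (j ℕ.+ k) mod m

  Shifts : ∀ {n} → Matrix n → ℕ → Set
  Shifts [] j = ⊤
  Shifts (r ∷ A) j = RowShifts r j × Shifts A (suc j)

  lincomb-shifts : ∀ {n} {A : Matrix n} {j} → Shifts A j → ∀ r k → ⟪ lincomb r A ⟫ k ≡ ⟪ r ⟫ (j ℕ.+ k) mod m
  lincomb-shifts {A = []} _ [] k = mod-reflexive (⟪⟫-replicate-0 (suc d) k)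
  lincomb-shifts {A = row ∷ A} {j} (row-shifts , A-shifts) (a ∷ r) k = begin
    ⟪ zipWith ℕ._+_ (map (a ℕ.*_) row) (lincomb r A) ⟫ k  ≡⟨ ⟪⟫-+ (map (a ℕ.*_) row) (lincomb r A) k ⟩
    ⟪ map (a ℕ.*_) row ⟫ k + ⟪ lincomb r A ⟫ k            ≡⟨ cong (_+ ⟪ lincomb r A ⟫ k) (⟪⟫-* a row k) ⟩
    + a * ⟪ row ⟫ k + ⟪ lincomb r A ⟫ k                   ≈⟨ +-mod-cong (*-mod-congˡ (+ a) (row-shifts k))
                                                                         (lincomb-shifts A-shifts r k) ⟩
    + a * s (j ℕ.+ k) + ⟪ r ⟫ (suc j ℕ.+ k)               ∎
    where open mod-Reasoning m

  ⊗-shifts : ∀ {n} {A : Matrix (suc d)} {B : Matrix n} {i j} → Shifts A j → Shifts B i → Shifts (B ⊗ A) (i ℕ.+ j)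
  ⊗-shifts {B = []} A-shifts B-shifts = tt
  ⊗-shifts {A = A} {r ∷ B} {i} {j} A-shifts (r-shifts , B-shifts) = row-shifts , ⊗-shifts A-shifts B-shifts
    where
    row-shifts : RowShifts (map (ℕ._% m) (lincomb r A)) (i ℕ.+ j)
    row-shifts k = begin
      ⟪ map (ℕ._% m) (lincomb r A) ⟫ k  ≈⟨ ⟪⟫-% (lincomb r A) k ⟩
      ⟪ lincomb r A ⟫ k                 ≈⟨ lincomb-shifts A-shifts r k ⟩
      ⟪ r ⟫ (j ℕ.+ k)                   ≈⟨ r-shifts (j ℕ.+ k) ⟩
      s (i ℕ.+ (j ℕ.+ k))               ≡⟨ cong s (ℕ.+-assoc i j k) ⟨
      s (i ℕ.+ j ℕ.+ k)                 ∎
      where open mod-Reasoning m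

  ⟪unit⟫ : ∀ j n k → j ℕ.< n → ⟪ unit j n ⟫ k ≡ s (j ℕ.+ k)
  ⟪unit⟫ zero (suc n) k _ = trans (cong (λ y → + 1 * s k + y) (⟪⟫-replicate-0 n (suc k)))
                                  (trans (ℤ.+-identityʳ _) (ℤ.*-identityˡ (s k)))
  ⟪unit⟫ (suc j) (suc n) k (ℕ.s≤s j<n) = trans (ℤ.+-identityˡ _)
                                               (trans (⟪unit⟫ j n (suc k) j<n) (cong s (ℕ.+-suc j k)))

  units-shifts : ∀ j n → j ℕ.+ n ℕ.≤ suc d → Shifts (units j n) j
  units-shifts j zero _ = tt
  units-shifts j (suc n) j+n<D = (λ k → mod-reflexive (⟪unit⟫ j (suc d) k j<D)) ,
                                 units-shifts (suc j) n (subst (ℕ._≤ suc d) (ℕ.+-suc j n) j+n<D)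
    where
    j<D : j ℕ.< suc d
    j<D = ℕ.<-≤-trans (ℕ.m<m+n j (ℕ.s≤s ℕ.z≤n)) j+n<D

  Shifts-∷ʳ : ∀ {n} {A : Matrix n} {j r} → Shifts A j → RowShifts r (n ℕ.+ j) → Shifts (A ∷ʳ r) j
  Shifts-∷ʳ {A = []} _ r-shifts = r-shifts , tt
  Shifts-∷ʳ {suc n} {A = _ ∷ A} {j} {r} (row-shifts , A-shifts) r-shifts =
    row-shifts , Shifts-∷ʳ A-shifts (subst (RowShifts r) (sym (ℕ.+-suc n j)) r-shifts)

  IsWindow : ∀ {n} → Vec ℕ n → ℕ → Set
  IsWindow [] k = ⊤
  IsWindow (x ∷ v) k = + x ≡ s k mod m × IsWindow v (suc k)

  window-isWindow : ∀ k n → IsWindow (window k n) k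
  window-isWindow k zero = tt
  window-isWindow k (suc n) = %ℕ-mod m (s k) , window-isWindow (suc k) n

  dot-window : ∀ {n k} {v : Vec ℕ n} → IsWindow v k → ∀ r → + sum (zipWith ℕ._*_ r v) ≡ ⟪ r ⟫ k mod m
  dot-window {v = []} _ [] = mod-refl
  dot-window {k = k} {x ∷ v} (x≡sk , v-window) (a ∷ r) = begin
    + (a ℕ.* x ℕ.+ sum (zipWith ℕ._*_ r v))     ≡⟨ ℤ.pos-+ (a ℕ.* x) _ ⟩
    + (a ℕ.* x) + + sum (zipWith ℕ._*_ r v)     ≡⟨ cong (_+ + sum (zipWith ℕ._*_ r v)) (ℤ.pos-* a x) ⟩
    + a * + x + + sum (zipWith ℕ._*_ r v)       ≈⟨ +-mod-cong (*-mod-congˡ (+ a) x≡sk) (dot-window v-window r) ⟩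
    + a * s k + ⟪ r ⟫ (suc k)                   ∎
    where open mod-Reasoning m

  apply-window : ∀ {n} {A : Matrix n} {j k v} → Shifts A j → IsWindow v k → IsWindow (apply A v) (j ℕ.+ k)
  apply-window {A = []} _ _ = tt
  apply-window {A = r ∷ A} {j} {k} {v} (r-shifts , A-shifts) v-window =
    mod-trans (%ℕ-mod m (+ sum (zipWith ℕ._*_ r v))) (mod-trans (dot-window v-window r) (r-shifts k)) ,
    apply-window A-shifts v-window

  agreeMod : ∀ {n} q .{{_ : NonZero q}} → Vec ℕ n → Vec ℕ n → Bool
  agreeMod q [] [] = true
  agreeMod q (x ∷ u) (y ∷ v) = (x ℕ.% q ≡ᵇ y ℕ.% q) ∧ agreeMod q u v

  agreeMod-sound : ∀ {n q k k′} .{{_ : NonZero q}} {u v : Vec ℕ n} → q ℕ.∣ m → IsWindow u k → IsWindow v k′ →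
                   T (agreeMod q u v) → ∀ i → i ℕ.< n → s (k ℕ.+ i) ≡ s (k′ ℕ.+ i) mod q
  agreeMod-sound {q = q} {k} {k′} {x ∷ _} {y ∷ _} q∣m (x≡sk , _) (y≡sk′ , _) agree zero _ = begin
    s (k ℕ.+ 0)   ≡⟨ cong s (ℕ.+-identityʳ k) ⟩
    s k           ≈⟨ mod-sym (mod-weaken q∣m x≡sk) ⟩
    + x           ≈⟨ %-≡⇒mod q x y (ℕ.≡ᵇ⇒≡ _ _ (proj₁ (Equivalence.to T-∧ agree))) ⟩
    + y           ≈⟨ mod-weaken q∣m y≡sk′ ⟩
    s k′          ≡⟨ cong s (ℕ.+-identityʳ k′) ⟨
    s (k′ ℕ.+ 0)  ∎
    where open mod-Reasoning q
  agreeMod-sound {q = q} {k} {k′} {_ ∷ _} {_ ∷ _} q∣m (_ , u-window) (_ , v-window) agree (suc i) (ℕ.s≤s i<n) =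
    subst₂ (λ a b → s a ≡ s b mod q) (sym (ℕ.+-suc k i)) (sym (ℕ.+-suc k′ i))
      (agreeMod-sound q∣m u-window v-window (proj₂ (Equivalence.to T-∧ agree)) i i<n)

  repeat-period : ∀ {q} T → (∀ j → s (T ℕ.+ j) ≡ s j mod q) → ∀ t c → s (t ℕ.* T ℕ.+ c) ≡ s c mod q
  repeat-period T periodic zero c = mod-refl
  repeat-period T periodic (suc t) c =
    mod-trans (mod-reflexive (cong s (ℕ.+-assoc T (t ℕ.* T) c)))
              (mod-trans (periodic (t ℕ.* T ℕ.+ c)) (repeat-period T periodic t c))

  module Recurrent (recurrence : ∀ k → s (suc d ℕ.+ k) ≡ ⟪ coefficients ⟫ k mod m) where

    power-shifts : ∀ n → Shifts (power n) n
    power-shifts zero = units-shifts 0 (suc d) ℕ.≤-refl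
    power-shifts (suc n) = ⊗-shifts (power-shifts n) companion-shifts
      where
      companion-shifts : Shifts companion 1
      companion-shifts = Shifts-∷ʳ (units-shifts 1 d ℕ.≤-refl)
        λ k → mod-sym (subst (λ i → s (i ℕ.+ k) ≡ ⟪ coefficients ⟫ k mod m) (ℕ.+-comm 1 d) (recurrence k))

    periodic : ∀ {q} T → q ℕ.∣ m → (∀ i → i ℕ.< suc d → s (T ℕ.+ i) ≡ s i mod q) →
               ∀ j → s (T ℕ.+ j) ≡ s j mod q
    periodic {q} T q∣m initial = <-rec (λ j → s (T ℕ.+ j) ≡ s j mod q) step
      where
      step : ∀ j → (∀ {i} → i ℕ.< j → s (T ℕ.+ i) ≡ s i mod q) → s (T ℕ.+ j) ≡ s j mod q
      step j earlier with j ℕ.<? suc d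
      ... | yes j<D = initial j j<D
      ... | no j≮D = subst (λ j → s (T ℕ.+ j) ≡ s j mod q) D+k≡j beyond
        where
        k : ℕ
        k = j ℕ.∸ suc d
        D+k≡j : suc d ℕ.+ k ≡ j
        D+k≡j = ℕ.m+[n∸m]≡n (ℕ.≮⇒≥ j≮D)
        k+i<j : ∀ i → i ℕ.< suc d → k ℕ.+ i ℕ.< j
        k+i<j i i<D = subst (k ℕ.+ i ℕ.<_) (trans (ℕ.+-comm k (suc d)) D+k≡j) (ℕ.+-monoʳ-< k i<D)
        beyond : s (T ℕ.+ (suc d ℕ.+ k)) ≡ s (suc d ℕ.+ k) mod q
        beyond = begin
          s (T ℕ.+ (suc d ℕ.+ k))   ≡⟨ cong s (swap T (suc d) k) ⟩
          s (suc d ℕ.+ (T ℕ.+ k))   ≈⟨ mod-weaken q∣m (recurrence (T ℕ.+ k)) ⟩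
          ⟪ coefficients ⟫ (T ℕ.+ k) ≈⟨ ⟪⟫-agree coefficients T k (λ i i<D → earlier (k+i<j i i<D)) ⟩
          ⟪ coefficients ⟫ k         ≈⟨ mod-sym (mod-weaken q∣m (recurrence k)) ⟩
          s (suc d ℕ.+ k)           ∎
          where
          open mod-Reasoning q
          swap : ∀ a b c → a ℕ.+ (b ℕ.+ c) ≡ b ℕ.+ (a ℕ.+ c)
          swap = ℕ.solve-∀

  module Certificate (P : ℕ) .{{_ : NonZero P}} (exceptional : ℕ → ℕ → Bool) where

    period : ℕ → ℕ
    period e = P ℕ.* 2 ℕ.^ e

    -- Certifies that s has no zero on the class of c modulo period e, given the window v of s at c:
    -- either s c ≢ 0 modulo 2^e, which settles the class since s mod 2^e has period (period e),
    -- or the class is exceptional, or it splits into the classes of c and period e + c modulo period (e + 1).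
    certify : (e c : ℕ) → Vec ℕ (suc d) → List (Matrix (suc d)) → Bool
    certify e c v [] = false
    certify e c v (A ∷ As) =
      not (ℕ._%_ (head v) (2 ℕ.^ e) {{ℕ.m^n≢0 2 e}} ≡ᵇ 0) ∨ exceptional e c ∨
      (certify (suc e) c v As ∧ certify (suc e) (period e ℕ.+ c) (apply A v) As)

    certifyResidues : ℕ → List (Matrix (suc d)) → Bool
    certifyResidues zero As = true
    certifyResidues (suc c) As = certify 0 c (window c (suc d)) As ∧ certifyResidues c As

    checkLevels : ℕ → Vec ℕ (suc d) → List (Matrix (suc d)) → Bool
    checkLevels e w₀ [] = true
    checkLevels e w₀ (A ∷ As) =
      (ℕ._%_ m (2 ℕ.^ e) {{ℕ.m^n≢0 2 e}} ≡ᵇ 0) ∧ agreeMod (2 ℕ.^ e) {{ℕ.m^n≢0 2 e}} (apply A w₀) w₀ ∧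
      checkLevels (suc e) w₀ As

    squarings : ℕ → Matrix (suc d) → List (Matrix (suc d))
    squarings zero A = []
    squarings (suc n) A = A ∷ squarings n (A ⊗ A)

    certified : List (Matrix (suc d)) → Bool
    certified As = checkLevels 0 (window 0 (suc d)) As ∧ certifyResidues P As

    module Sound (recurrence : ∀ k → s (suc d ℕ.+ k) ≡ ⟪ coefficients ⟫ k mod m)
                 (Allowed : ℕ → Set)
                 (exceptional-sound : ∀ e c → T (exceptional e c) → ∀ t → ¬ Allowed (t ℕ.* period e ℕ.+ c)) where

      open Recurrent recurrence

      Level : ℕ → Matrix (suc d) → Set
      Level e A = 2 ℕ.^ e ℕ.∣ m × Shifts A (period e) × (∀ j → s (period e ℕ.+ j) ≡ s j mod 2 ℕ.^ e)

      data Levels : ℕ → List (Matrix (suc d)) → Set where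
        [] : ∀ {e} → Levels e []
        _∷_ : ∀ {e A As} → Level e A → Levels (suc e) As → Levels e (A ∷ As)

      squarings-levels : ∀ n e {A} → Shifts A (period e) → T (checkLevels e (window 0 (suc d)) (squarings n A)) →
                         Levels e (squarings n A)
      squarings-levels zero e _ _ = []
      squarings-levels (suc n) e {A} A-shifts checks with Equivalence.to T-∧ checks
      ... | m%2^e≡0 , checks′ with Equivalence.to T-∧ checks′
      ... | agree , rest =
        (2^e∣m , A-shifts , periodic (period e) 2^e∣m initial) ∷
        squarings-levels n (suc e) (subst (Shifts (A ⊗ A)) (double P (2 ℕ.^ e)) (⊗-shifts A-shifts A-shifts)) rest
        where
        2^e∣m : 2 ℕ.^ e ℕ.∣ m
        2^e∣m = ℕ.m%n≡0⇒n∣m m (2 ℕ.^ e) {{ℕ.m^n≢0 2 e}} (ℕ.≡ᵇ⇒≡ _ 0 m%2^e≡0)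
        initial : ∀ i → i ℕ.< suc d → s (period e ℕ.+ i) ≡ s i mod 2 ℕ.^ e
        initial = agreeMod-sound {{ℕ.m^n≢0 2 e}} 2^e∣m
          (subst (IsWindow (apply A (window 0 (suc d)))) (ℕ.+-identityʳ (period e))
                 (apply-window A-shifts (window-isWindow 0 (suc d))))
          (window-isWindow 0 (suc d)) agree
        double : ∀ p x → p ℕ.* x ℕ.+ p ℕ.* x ≡ p ℕ.* (2 ℕ.* x)
        double = ℕ.solve-∀

      transport : ∀ {k k′} → k ≡ k′ → (Allowed k′ → s k′ ≢ + 0) → Allowed k → s k ≢ + 0
      transport refl nonzero = nonzero

      certify-sound : ∀ {e c v As} → Levels e As → IsWindow v c → T (certify e c v As) →
                      ∀ t → Allowed (t ℕ.* period e ℕ.+ c) → s (t ℕ.* period e ℕ.+ c) ≢ + 0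
      certify-sound {e} {c} {x ∷ v} {A ∷ As} ((2^e∣m , A-shifts , periodic-e) ∷ levels) v-window checks t
        with Equivalence.to T-∨ checks
      ... | inj₁ x≢0 = λ _ s≡0 →
        subst T (Equivalence.to T-not-≡ x≢0)
                (ℕ.≡⇒≡ᵇ _ 0 (ℕ.n∣m⇒m%n≡0 x (2 ℕ.^ e) {{ℕ.m^n≢0 2 e}} (mod-0⇒∣ (x≡0 s≡0))))
        where
        x≡0 : s (t ℕ.* period e ℕ.+ c) ≡ + 0 → + x ≡ + 0 mod 2 ℕ.^ e
        x≡0 s≡0 = begin
          + x                         ≈⟨ mod-weaken 2^e∣m (proj₁ v-window) ⟩
          s c                         ≈⟨ mod-sym (repeat-period (period e) periodic-e t c) ⟩
          s (t ℕ.* period e ℕ.+ c)    ≡⟨ s≡0 ⟩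
          + 0                         ∎
          where open mod-Reasoning (2 ℕ.^ e)
      ... | inj₂ checks′ with Equivalence.to T-∨ checks′
      ... | inj₁ is-exceptional = λ allowed → contradiction allowed (exceptional-sound e c is-exceptional t)
      ... | inj₂ both
        with Equivalence.to (T-∧ {certify (suc e) c (x ∷ v) As}
                                 {certify (suc e) (period e ℕ.+ c) (apply A (x ∷ v)) As}) both
           | t ℕ.divMod 2
      ... | same , _ | ℕ.result u Fin.zero refl =
        transport (even u P (2 ℕ.^ e) c) (certify-sound levels v-window same u)
        where
        even : ∀ u p x c → u ℕ.* 2 ℕ.* (p ℕ.* x) ℕ.+ c ≡ u ℕ.* (p ℕ.* (2 ℕ.* x)) ℕ.+ c
        even = ℕ.solve-∀
      ... | _ , shifted | ℕ.result u (Fin.suc Fin.zero) refl =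
        transport (odd u P (2 ℕ.^ e) c) (certify-sound levels (apply-window A-shifts v-window) shifted u)
        where
        odd : ∀ u p x c →
              (1 ℕ.+ u ℕ.* 2) ℕ.* (p ℕ.* x) ℕ.+ c ≡ u ℕ.* (p ℕ.* (2 ℕ.* x)) ℕ.+ (p ℕ.* x ℕ.+ c)
        odd = ℕ.solve-∀

      certifyResidues-sound : ∀ {As} n c → c ℕ.< n → T (certifyResidues n As) → T (certify 0 c (window c (suc d)) As)
      certifyResidues-sound {As} (suc n) c c<1+n checks
        with ℕ.m<1+n⇒m<n∨m≡n c<1+n
           | Equivalence.to (T-∧ {certify 0 n (window n (suc d)) As} {certifyResidues n As}) checks
      ... | inj₁ c<n | _ , rest = certifyResidues-sound n c c<n rest
      ... | inj₂ refl | certified-c , _ = certified-c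

      certified-sound : ∀ n → certified (squarings n (power P)) ≡ true → ∀ k → Allowed k → s k ≢ + 0
      certified-sound n certified≡true k
        with Equivalence.to (T-∧ {checkLevels 0 (window 0 (suc d)) (squarings n (power P))}
                                 {certifyResidues P (squarings n (power P))}) (subst T (sym certified≡true) tt)
           | k ℕ.divMod P
      ... | level-checks , residue-checks | ℕ.result u r refl =
        transport (reorder (Fin.toℕ r) u P)
          (certify-sound levels (window-isWindow (Fin.toℕ r) (suc d))
                         (certifyResidues-sound P (Fin.toℕ r) (Fin.toℕ<n r) residue-checks) u)
        where
        levels : Levels 0 (squarings n (power P))
        levels = squarings-levels n 0 (subst (Shifts (power P)) (sym (ℕ.*-identityʳ P)) (power-shifts P)) level-checks
        reorder : ∀ r u p → r ℕ.+ u ℕ.* p ≡ u ℕ.* (p ℕ.* 1) ℕ.+ r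
        reorder = ℕ.solve-∀

open import Data.Nat using (ℕ; _+_; _*_; _%_; _^_)

M : ℕ
M = 2 ^ 22

H22-monic : last (H 22) ≡ + 1
H22-monic = refl

-- The two residue classes on which the 2-adic search cannot decide.
exceptional : ℕ → ℕ → Bool
exceptional e c = (e ≡ᵇ 20) ∧ ((c ≡ᵇ 1) ∨ (c ≡ᵇ 2944837))

Allowed : ℕ → Set
Allowed k = (k + 1) % 3145728 ≢ 2 × (k + 1) % 3145728 ≢ 2944838

-- The coefficient vector is spelled out rather than named: relating a name to its value would make
-- the type checker normalise H 22 outside the single evaluation performed by certificate.
open LinearRecurrence M (map (λ a → (- a) ℤ.%ℕ M) (init (H 22))) β
open Certificate 3 exceptional

-- An equation rather than T (certified …), whose type would be normalised wherever it is checked.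
certificate : certified (squarings 23 (power 3)) ≡ true
certificate = refl

[tn+c+1]%n≡[c+1]%n : ∀ n .{{_ : NonZero n}} t c → (t * n + c + 1) % n ≡ (c + 1) % n
[tn+c+1]%n≡[c+1]%n n t c = trans (cong (_% n) (reorder t n c)) (ℕ.[m+kn]%n≡m%n (c + 1) t n)
  where
  reorder : ∀ t n c → t * n + c + 1 ≡ c + 1 + t * n
  reorder = ℕ.solve-∀

exceptional-sound : ∀ e c → T (exceptional e c) → ∀ t → ¬ Allowed (t * period e + c)
exceptional-sound e c is-exceptional t
  with Equivalence.to (T-∧ {e ≡ᵇ 20} {(c ≡ᵇ 1) ∨ (c ≡ᵇ 2944837)}) is-exceptional
... | e≡20 , c-cases with ℕ.≡ᵇ⇒≡ e 20 e≡20 | Equivalence.to (T-∨ {c ≡ᵇ 1} {c ≡ᵇ 2944837}) c-cases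
... | refl | inj₁ c≡1 rewrite ℕ.≡ᵇ⇒≡ c 1 c≡1 =
  λ allowed → proj₁ allowed ([tn+c+1]%n≡[c+1]%n 3145728 t 1)
... | refl | inj₂ c≡2944837 rewrite ℕ.≡ᵇ⇒≡ c 2944837 c≡2944837 =
  λ allowed → proj₂ allowed ([tn+c+1]%n≡[c+1]%n 3145728 t 2944837)

module _ (p : ℕ) .{{_ : NonZero p}} (α-irrational : ¬ SeriesIsRational p αTerm) where

  β-recurrence : ∀ k → β (44 + k) ≡ combination (map +_ (map (λ a → (- a) ℤ.%ℕ M) (init (H 22)))) β k mod M
  β-recurrence = monic-recurrence M (H 22) β H22-monic λ k →
    congruent (subst (+ M ∣_) (sym (ℤ.+-identityʳ _)) (2^r∣combination-H-β p α-irrational 22 k))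

  β-nonzero : ∀ k → Allowed k → β k ≢ + 0
  β-nonzero = certified-sound 23 certificate
    where open Sound β-recurrence Allowed exceptional-sound

corollary4p6 : (p : ℕ) → Prime p → (k : ℕ) →
    ¬ SeriesIsRational p αTerm →
    (k + 1) % 3145728 ≢ 2 →
    (k + 1) % 3145728 ≢ 2944838 →
    ¬ SeriesIsRational p (αkTerm k)
corollary4p6 p p-prime k α-irrational k+1≢2 k+1≢2944838 =
  expansion-irrational p α-irrational (proj₂ (expansionOf (monomial k)))
                       (β-nonzero p α-irrational k (k+1≢2 , k+1≢2944838))
  ∘ SeriesIsRational-cong (αkTerm-monomial k)
  where
  instance
    p≢0 : NonZero p
    p≢0 = prime⇒nonZero p-prime
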